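{- Let $P=[a_1]\times\cdots\times[a_n]$ and $I\in J(P)$. Let $v,u\in\{\pm1\}^n$ and $\gamma\in\{1,\dots,n\}$ be such that $v_\gamma=1$, $u_\gamma=-1$, and $v_j=u_j$ for all $j\neq\gamma$. Then $\mathrm{Pro}_u(\Delta^\gamma_v I)=\Delta^\gamma_v(\mathrm{Pro}_v(I))$, where $\Delta^\gamma_v I=\bigcup_{j=1}^{a_\gamma}L^j_\gamma(\mathrm{Pro}_v^{j-1}(I))$.
   Context: $[m]=\{1,\dots,m\}$; $P$ has the componentwise order, elements viewed as vectors in $\mathbb{Z}^n$; $J(P)$ is the set of order ideals of $P$. The toggle $t_e(I)$ is $I\cup\{e\}$ if $e\notin I$ and this is an order ideal, $I\setminus\{e\}$ if $e\in I$ and this is an order ideal, and $I$ otherwise. For $w\in\{\pm1\}^n$, $T^i_w$ is the (commuting) product of toggles $t_x$ over $x\in P$ with $\langle x,w\rangle=i$, and $\mathrm{Pro}_w=\cdots T^{ -1}_wT^0_wT^1_w\cdots$ applies the $T^i_w$ in decreasing order of $i$. For $I\in J(P)$, $L^j_\gamma(I)=\{x\in I: x_\gamma=j\}$. The set $\Delta^\gamma_v I$ is called the $(v,\gamma)$-recombination of $I$ (it is an order ideal when $v_\gamma=1$). -}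

module Defs where

open import Data.Nat as ℕ using (ℕ; zero; suc; _∸_; _≤_; _≤ᵇ_; _<ᵇ_; _≡ᵇ_)
open import Data.Integer as ℤ using (ℤ; _◃_; +_)
open import Data.Sign using (Sign)
open import Data.Bool using (Bool; true; false; if_then_else_; _∧_; not)
import Data.Bool
open import Data.Fin using (Fin)
open import Data.List.Base using (List; []; _∷_; all; allFin; foldr; foldl; map; upTo)
open import Data.Vec.Functional using (updateAt)
open import Data.Product using (_×_)
open import Relation.Binary.PropositionalEquality using (_≡_)
open import Relation.Nullary.Decidable using (⌊_⌋)
open import Function using (_∘_)

-- Elements of ℤ^n (we only need positive coordinates): vectors Fin n → ℕ.
Point : ℕ → Set
Point n = Fin n → ℕ

InP : ∀ {n} → (Fin n → ℕ) → Point n → Set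
InP a x = ∀ i → (1 ≤ x i) × (x i ≤ a i)

inPᵇ : ∀ {n} → (Fin n → ℕ) → Point n → Bool
inPᵇ {n} a x = all (λ i → (1 ≤ᵇ x i) ∧ (x i ≤ᵇ a i)) (allFin n)

Subset : ℕ → Set
Subset n = Point n → Bool

IsOrderIdeal : ∀ {n} → (Fin n → ℕ) → Subset n → Set
IsOrderIdeal a S =
  (∀ x → S x ≡ true → InP a x) ×
  (∀ x y → InP a y → (∀ i → y i ≤ x i) → S x ≡ true → S y ≡ true)

up down : ∀ {n} → Point n → Fin n → Point n
up   x i = updateAt x i suc
down x i = updateAt x i (λ k → k ∸ 1)

-- For an order ideal S of P:  S ∪ {e} is an order ideal iff e ∈ P and every
-- lower cover of e in P lies in S;  S ∖ {e} is an order ideal iff no upper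
-- cover of e in P lies in S.
canAdd : ∀ {n} → (Fin n → ℕ) → Subset n → Point n → Bool
canAdd {n} a S e =
  inPᵇ a e ∧ all (λ i → if 2 ≤ᵇ e i then S (down e i) else true) (allFin n)

canRemove : ∀ {n} → (Fin n → ℕ) → Subset n → Point n → Bool
canRemove {n} a S e =
  all (λ i → if e i <ᵇ a i then not (S (up e i)) else true) (allFin n)

toggle : ∀ {n} → (Fin n → ℕ) → Point n → Subset n → Subset n
toggle {n} a e S x =
  if all (λ i → x i ≡ᵇ e i) (allFin n)
  then (if S e then not (canRemove a S e) else canAdd a S e)
  else S x

SignVec : ℕ → Set
SignVec n = Fin n → Sign

⟨_,_⟩ : ∀ {n} → Point n → SignVec n → ℤ
⟨_,_⟩ {n} x w = foldr (λ i s → (w i ◃ x i) ℤ.+ s) (+ 0) (allFin n)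

-- T^i_w : the product of the toggles t_x over x with ⟨x,w⟩ = i.  Elements on
-- the same level are never in a cover relation, so these toggles commute and
-- their product is the simultaneous toggle below.
T : ∀ {n} → (Fin n → ℕ) → SignVec n → ℤ → Subset n → Subset n
T a w i S x = if ⌊ ⟨ x , w ⟩ ℤ.≟ i ⌋ then toggle a x S x else S x

-- Every x ∈ P has |⟨x,w⟩| ≤ N := a_1 + ⋯ + a_n, so the levels that matter are
-- N, N-1, …, -N (listed in decreasing order).
total : ∀ {n} → (Fin n → ℕ) → ℕ
total {n} a = foldr (λ i s → a i ℕ.+ s) 0 (allFin n)

levels : ∀ {n} → (Fin n → ℕ) → List ℤ
levels a = map (λ k → + total a ℤ.- + k) (upTo (suc (2 ℕ.* total a)))

-- Pro_w = ⋯ T^{-1}_w T^0_w T^1_w ⋯  (T^i_w applied in decreasing order of i).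
Pro : ∀ {n} → (Fin n → ℕ) → SignVec n → Subset n → Subset n
Pro a w S = foldl (λ R i → T a w i R) S (levels a)

iter : ∀ {A : Set} → ℕ → (A → A) → A → A
iter zero    f x = x
iter (suc k) f x = f (iter k f x)

L : ∀ {n} → ℕ → Fin n → Subset n → Subset n
L j γ S x = (x γ ≡ᵇ j) ∧ S x

unionUpTo : ∀ {n} → ℕ → (ℕ → Subset n) → Subset n
unionUpTo zero    F x = false
unionUpTo (suc m) F x = unionUpTo m F x Data.Bool.∨ F (suc m) x

Δ : ∀ {n} → (Fin n → ℕ) → Fin n → SignVec n → Subset n → Subset n
Δ a γ v I = unionUpTo (a γ) (λ j → L j γ (iter (j ∸ 1) (Pro a v) I))

module Submission where

-- Pro_w toggles the w-levels from the top down, and whether t_x adds or removes x depends only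
-- on x and its neighbours x ± e_i.  So Pro_w(S) at x is t_x applied to a state that agrees with
-- S at x and one level below, and with Pro_w(S) one level above.  On the layer
-- y_γ = c + 1, Δ^γ_v I agrees with Pro_v^c(I) and Δ^γ_v(Pro_v I) with Pro_v^{c+1}(I).  We prove
-- the identity at y by downward induction on the u-level of y: both sides are then values of the
-- toggle t_y, and because u and v differ only in the sign at γ, the two states being toggled agree
-- at y and at all its neighbours.

open import Defs
open import Data.Bool using (Bool; true; false; if_then_else_; _∧_; _∨_; not)
open import Data.Bool.ListAction using (and; all)
open import Data.Bool.Properties using (T-≡; T-∧; ∧-conicalˡ; ∧-conicalʳ; ∨-identityʳ)
open import Data.Fin as Fin using (Fin)
open import Data.Integer as ℤ using (ℤ; _◃_; +_; -[1+_])
import Data.Integer.Properties as ℤP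
open import Data.List.Base using ([]; _∷_; [_]; _++_; _∷ʳ_; foldr; foldl; map; allFin; upTo)
open import Data.List.Properties using (foldr-cong; foldr-map; map-tabulate; map-cong; map-++; foldl-∷ʳ; upTo-∷ʳ)
open import Data.List.Relation.Unary.All.Properties using (all⁺; all⁻; tabulate⁺; tabulate⁻)
open import Data.Nat as ℕ using (ℕ; zero; suc; _∸_; _≤_; _<_; _≤ᵇ_; _<ᵇ_; _≡ᵇ_; z≤n; s≤s)
import Data.Nat.Properties as ℕP
open import Data.Product using (Σ-syntax; _×_; _,_; proj₁; proj₂)
open import Data.Sign as Sign using (Sign)
open import Data.Sum using (inj₁; inj₂)
open import Data.Vec.Functional using (updateAt)
open import Data.Vec.Functional.Properties
  using (updateAt-updateAt-local; updateAt-id; updateAt-updates; updateAt-minimal)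
open import Function using (_∘_; _$_)
open import Function.Bundles using (Equivalence)
open import Relation.Binary.PropositionalEquality
  using (_≡_; _≢_; _≗_; refl; sym; trans; cong; cong₂; subst; module ≡-Reasoning)
open import Relation.Nullary using (¬_; yes; no; contradiction)
open import Relation.Nullary.Decidable using (dec-true; dec-false)

open import Algebra.Properties.AbelianGroup ℤP.+-0-abelianGroup using (∙-cancelˡ; x≈z//y; //-rightDividesˡ)
open import Algebra.Properties.CommutativeSemigroup ℤP.+-commutativeSemigroup
  using (xy∙z≈yz∙x; x∙yz≈y∙xz; interchange)

inPᵇ⇒InP : ∀ {n} (a : Fin n → ℕ) x → inPᵇ a x ≡ true → InP a x
inPᵇ⇒InP a x x∈P i =
  let lo , hi = Equivalence.to T-∧ (tabulate⁻ (all⁺ _ (allFin _) (Equivalence.from T-≡ x∈P)) i)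
  in ℕP.≤ᵇ⇒≤ 1 (x i) lo , ℕP.≤ᵇ⇒≤ (x i) (a i) hi

InP⇒inPᵇ : ∀ {n} (a : Fin n → ℕ) x → InP a x → inPᵇ a x ≡ true
InP⇒inPᵇ a x x∈P = Equivalence.to T-≡ (all⁻ _ (tabulate⁺ λ i →
  Equivalence.from T-∧ (ℕP.≤⇒≤ᵇ (proj₁ (x∈P i)) , ℕP.≤⇒≤ᵇ (proj₂ (x∈P i)))))

foldr-allFin-suc : ∀ {B : Set} {n} (f : Fin (suc n) → B → B) e →
  foldr f e (allFin (suc n)) ≡ f Fin.zero (foldr (f ∘ Fin.suc) e (allFin n))
foldr-allFin-suc {n = n} f e =
  cong (f Fin.zero) (trans (cong (foldr f e) (sym (map-tabulate (λ i → i) Fin.suc)))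
                           (foldr-map f Fin.suc e (allFin n)))

⟨⟩-suc : ∀ {n} (x : Point (suc n)) (w : SignVec (suc n)) →
  ⟨ x , w ⟩ ≡ (w Fin.zero ◃ x Fin.zero) ℤ.+ ⟨ x ∘ Fin.suc , w ∘ Fin.suc ⟩
⟨⟩-suc x w = foldr-allFin-suc (λ i s → (w i ◃ x i) ℤ.+ s) (+ 0)

total-suc : ∀ {n} (a : Fin (suc n) → ℕ) → total a ≡ a Fin.zero ℕ.+ total (a ∘ Fin.suc)
total-suc a = foldr-allFin-suc (λ i s → a i ℕ.+ s) 0

⟨⟩-cong : ∀ {n} {x y : Point n} (w : SignVec n) → x ≗ y → ⟨ x , w ⟩ ≡ ⟨ y , w ⟩
⟨⟩-cong w x≗y = foldr-cong (λ i s → cong (λ k → (w i ◃ k) ℤ.+ s) (x≗y i)) refl (allFin _)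

⟨⟩-up : ∀ {n} (x : Point n) (w : SignVec n) i → ⟨ up x i , w ⟩ ≡ ⟨ x , w ⟩ ℤ.+ (w i ◃ 1)
⟨⟩-up {suc n} x w Fin.zero = begin
  ⟨ up x Fin.zero , w ⟩               ≡⟨ ⟨⟩-suc (up x Fin.zero) w ⟩
  (w₀ ◃ (1 ℕ.+ x₀)) ℤ.+ rest          ≡⟨ cong (ℤ._+ rest) (ℤP.◃-distrib-+ w₀ 1 x₀) ⟩
  ((w₀ ◃ 1) ℤ.+ (w₀ ◃ x₀)) ℤ.+ rest   ≡⟨ xy∙z≈yz∙x (w₀ ◃ 1) (w₀ ◃ x₀) rest ⟩
  ((w₀ ◃ x₀) ℤ.+ rest) ℤ.+ (w₀ ◃ 1)   ≡⟨ cong (ℤ._+ (w₀ ◃ 1)) (⟨⟩-suc x w) ⟨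
  ⟨ x , w ⟩ ℤ.+ (w₀ ◃ 1)              ∎
  where
  open ≡-Reasoning
  w₀ = w Fin.zero
  x₀ = x Fin.zero
  rest = ⟨ x ∘ Fin.suc , w ∘ Fin.suc ⟩
⟨⟩-up {suc n} x w (Fin.suc i) = begin
  ⟨ up x (Fin.suc i) , w ⟩            ≡⟨ ⟨⟩-suc (up x (Fin.suc i)) w ⟩
  t₀ ℤ.+ ⟨ up x′ i , w′ ⟩             ≡⟨ cong (λ s → t₀ ℤ.+ s) (⟨⟩-up x′ w′ i) ⟩
  t₀ ℤ.+ (⟨ x′ , w′ ⟩ ℤ.+ tᵢ)          ≡⟨ ℤP.+-assoc t₀ _ tᵢ ⟨
  (t₀ ℤ.+ ⟨ x′ , w′ ⟩) ℤ.+ tᵢ          ≡⟨ cong (ℤ._+ tᵢ) (⟨⟩-suc x w) ⟨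
  ⟨ x , w ⟩ ℤ.+ tᵢ                    ∎
  where
  open ≡-Reasoning
  x′ = x ∘ Fin.suc
  w′ = w ∘ Fin.suc
  t₀ = w Fin.zero ◃ x Fin.zero
  tᵢ = w (Fin.suc i) ◃ 1

suc[m∸1]≡m : ∀ {m} → 1 ≤ m → suc (m ∸ 1) ≡ m
suc[m∸1]≡m {suc m} _ = refl

up∘down≗id : ∀ {n} (x : Point n) i → 1 ≤ x i → up (down x i) i ≗ x
up∘down≗id x i 1≤xᵢ j = trans (updateAt-updateAt-local i x (suc[m∸1]≡m 1≤xᵢ) j) (updateAt-id i x j)

up-raises-level : ∀ {n} (x : Point n) {w : SignVec n} {i} → w i ≡ Sign.+ → ⟨ up x i , w ⟩ ≡ ⟨ x , w ⟩ ℤ.+ + 1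
up-raises-level x {w} {i} wᵢ = trans (⟨⟩-up x w i) (cong (λ s → ⟨ x , w ⟩ ℤ.+ (s ◃ 1)) wᵢ)

up-lowers-level : ∀ {n} (x : Point n) {w : SignVec n} {i} → w i ≡ Sign.- → ⟨ x , w ⟩ ≡ ⟨ up x i , w ⟩ ℤ.+ + 1
up-lowers-level x {w} {i} wᵢ = begin
  X                            ≡⟨ ℤP.+-identityʳ X ⟨
  X ℤ.+ (-[1+ 0 ] ℤ.+ + 1)     ≡⟨ ℤP.+-assoc X -[1+ 0 ] (+ 1) ⟨
  (X ℤ.+ -[1+ 0 ]) ℤ.+ + 1     ≡⟨ cong (λ s → (X ℤ.+ (s ◃ 1)) ℤ.+ + 1) wᵢ ⟨
  (X ℤ.+ (w i ◃ 1)) ℤ.+ + 1    ≡⟨ cong (ℤ._+ + 1) (⟨⟩-up x w i) ⟨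
  ⟨ up x i , w ⟩ ℤ.+ + 1       ∎
  where
  open ≡-Reasoning
  X = ⟨ x , w ⟩

down-lowers-level : ∀ {n} (x : Point n) {w : SignVec n} {i} → 1 ≤ x i → w i ≡ Sign.+ →
  ⟨ x , w ⟩ ≡ ⟨ down x i , w ⟩ ℤ.+ + 1
down-lowers-level x {w} {i} 1≤xᵢ wᵢ =
  trans (⟨⟩-cong w (sym ∘ up∘down≗id x i 1≤xᵢ)) (up-raises-level (down x i) wᵢ)

down-raises-level : ∀ {n} (x : Point n) {w : SignVec n} {i} → 1 ≤ x i → w i ≡ Sign.- →
  ⟨ down x i , w ⟩ ≡ ⟨ x , w ⟩ ℤ.+ + 1
down-raises-level x {w} {i} 1≤xᵢ wᵢ =
  trans (up-lowers-level (down x i) wᵢ) (cong (ℤ._+ + 1) (⟨⟩-cong w (up∘down≗id x i 1≤xᵢ)))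

-- x lies on the d-th level N − d visited by Pro_w, where N = total a.
record HasDepth {n} (a : Fin n → ℕ) (w : SignVec n) (x : Point n) (d : ℕ) : Set where
  constructor depth
  field ⟨⟩+depth≡total : ⟨ x , w ⟩ ℤ.+ + d ≡ + total a

◃-depth : ∀ s {x c} → x ≤ c → Σ[ d ∈ ℕ ] d ≤ 2 ℕ.* c × (s ◃ x) ℤ.+ + d ≡ + c
◃-depth Sign.+ {x} {c} x≤c =
  c ∸ x , ℕP.≤-trans (ℕP.m∸n≤m c x) (ℕP.m≤m+n c _) ,
  trans (cong (ℤ._+ + (c ∸ x)) (ℤP.+◃n≡+n x)) (cong +_ (ℕP.m+[n∸m]≡n x≤c))
◃-depth Sign.- {x} {c} x≤c =
  c ℕ.+ x , ℕP.+-monoʳ-≤ c (ℕP.≤-trans x≤c (ℕP.m≤m+n c 0)) , (begin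
    (Sign.- ◃ x) ℤ.+ (+ c ℤ.+ + x)     ≡⟨ cong (ℤ._+ (+ c ℤ.+ + x)) (ℤP.-◃n≡-n x) ⟩
    ℤ.- + x ℤ.+ (+ c ℤ.+ + x)          ≡⟨ x∙yz≈y∙xz (ℤ.- + x) (+ c) (+ x) ⟩
    + c ℤ.+ (ℤ.- + x ℤ.+ + x)          ≡⟨ cong (λ s → + c ℤ.+ s) (ℤP.+-inverseˡ (+ x)) ⟩
    + c ℤ.+ + 0                        ≡⟨ ℤP.+-identityʳ (+ c) ⟩
    + c                                ∎)
  where open ≡-Reasoning

depth-exists : ∀ {n} (a : Fin n → ℕ) (w : SignVec n) {x} → InP a x →
  Σ[ d ∈ ℕ ] d ≤ 2 ℕ.* total a × HasDepth a w x d
depth-exists {zero} a w x∈P = 0 , z≤n , depth refl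
depth-exists {suc n} a w {x} x∈P
  with ◃-depth (w Fin.zero) (proj₂ (x∈P Fin.zero))
     | depth-exists (a ∘ Fin.suc) (w ∘ Fin.suc) (x∈P ∘ Fin.suc)
... | d₀ , d₀≤ , x₀-depth | d , d≤ , depth rest-depth = d₀ ℕ.+ d , bound , depth x-depth
  where
  a₀ = a Fin.zero
  N = total (a ∘ Fin.suc)
  bound : d₀ ℕ.+ d ≤ 2 ℕ.* total a
  bound = begin
    d₀ ℕ.+ d                  ≤⟨ ℕP.+-mono-≤ d₀≤ d≤ ⟩
    2 ℕ.* a₀ ℕ.+ 2 ℕ.* N      ≡⟨ ℕP.*-distribˡ-+ 2 a₀ N ⟨
    2 ℕ.* (a₀ ℕ.+ N)          ≡⟨ cong (2 ℕ.*_) (total-suc a) ⟨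
    2 ℕ.* total a             ∎
    where open ℕP.≤-Reasoning
  x-depth : ⟨ x , w ⟩ ℤ.+ + (d₀ ℕ.+ d) ≡ + total a
  x-depth = begin
    ⟨ x , w ⟩ ℤ.+ (+ d₀ ℤ.+ + d)                ≡⟨ cong (ℤ._+ (+ d₀ ℤ.+ + d)) (⟨⟩-suc x w) ⟩
    (t₀ ℤ.+ rest) ℤ.+ (+ d₀ ℤ.+ + d)            ≡⟨ interchange t₀ rest (+ d₀) (+ d) ⟩
    (t₀ ℤ.+ + d₀) ℤ.+ (rest ℤ.+ + d)            ≡⟨ cong₂ ℤ._+_ x₀-depth rest-depth ⟩
    + (a₀ ℕ.+ N)                                ≡⟨ cong +_ (total-suc a) ⟨
    + total a                                   ∎
    where
    open ≡-Reasoning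
    t₀ = w Fin.zero ◃ x Fin.zero
    rest = ⟨ x ∘ Fin.suc , w ∘ Fin.suc ⟩

depth-unique : ∀ {n} {a : Fin n → ℕ} {w x j d} → HasDepth a w x j → HasDepth a w x d → j ≡ d
depth-unique {w = w} {x = x} (depth dj) (depth dd) = ℤP.+-injective (∙-cancelˡ ⟨ x , w ⟩ _ _ (trans dj (sym dd)))

depth-below : ∀ {n} {a : Fin n → ℕ} {w} {x z : Point n} {d} →
  ⟨ z , w ⟩ ≡ ⟨ x , w ⟩ ℤ.+ + 1 → HasDepth a w z d → HasDepth a w x (suc d)
depth-below {w = w} {x} {z} {d} z-above (depth dz) = depth (begin
  ⟨ x , w ⟩ ℤ.+ (+ 1 ℤ.+ + d)   ≡⟨ ℤP.+-assoc ⟨ x , w ⟩ (+ 1) (+ d) ⟨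
  (⟨ x , w ⟩ ℤ.+ + 1) ℤ.+ + d   ≡⟨ cong (ℤ._+ + d) z-above ⟨
  ⟨ z , w ⟩ ℤ.+ + d             ≡⟨ dz ⟩
  _                             ∎)
  where open ≡-Reasoning

level : ∀ {n} → (Fin n → ℕ) → ℕ → ℤ
level a k = + total a ℤ.- + k

level-depth : ∀ {n} {a : Fin n → ℕ} {w x d} → ⟨ x , w ⟩ ≡ level a d → HasDepth a w x d
level-depth {a = a} {d = d} eq = depth $ trans (cong (ℤ._+ + d) eq) (//-rightDividesˡ (+ d) (+ total a))

depth-level : ∀ {n} {a : Fin n → ℕ} {w x d} → HasDepth a w x d → ⟨ x , w ⟩ ≡ level a d
depth-level {w = w} {x = x} {d = d} (depth eq) = x≈z//y ⟨ x , w ⟩ (+ d) _ eq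

toggleValue : ∀ {n} → (Fin n → ℕ) → Subset n → Point n → Bool
toggleValue a S x = if S x then not (canRemove a S x) else canAdd a S x

toggle-diagonal : ∀ {n} (a : Fin n → ℕ) x (S : Subset n) → toggle a x S x ≡ toggleValue a S x
toggle-diagonal a x S = cong (λ b → if b then toggleValue a S x else S x) x≡ᵇx
  where
  x≡ᵇx : all (λ i → x i ≡ᵇ x i) (allFin _) ≡ true
  x≡ᵇx = Equivalence.to T-≡ (all⁻ _ (tabulate⁺ λ i → ℕP.≡⇒≡ᵇ (x i) (x i) refl))

toggleValue-local : ∀ {n} (a : Fin n → ℕ) {R R' : Subset n} x → R x ≡ R' x →
  (∀ i → R (up x i) ≡ R' (up x i)) → (∀ i → R (down x i) ≡ R' (down x i)) →
  toggleValue a R x ≡ toggleValue a R' x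
toggleValue-local {n} a {R} {R'} x Rx≡R'x ups downs rewrite Rx≡R'x =
  cong₂ (λ remove add → if R' x then not remove else add)
    (cong and (map-cong (λ i → cong (λ b → if x i <ᵇ a i then not b else true) (ups i)) (allFin n)))
    (cong (λ bs → inPᵇ a x ∧ and bs)
      (map-cong (λ i → cong (λ b → if 2 ≤ᵇ x i then b else true) (downs i)) (allFin n)))

T-onLevel : ∀ {n} (a : Fin n → ℕ) {w ℓ} (R : Subset n) {y} → ⟨ y , w ⟩ ≡ ℓ → T a w ℓ R y ≡ toggleValue a R y
T-onLevel a {w} {ℓ} R {y} onLevel with ⟨ y , w ⟩ ℤ.≟ ℓ
... | yes _ = toggle-diagonal a y R
... | no offLevel = contradiction onLevel offLevel

T-offLevel : ∀ {n} (a : Fin n → ℕ) {w ℓ} (R : Subset n) {y} → ⟨ y , w ⟩ ≢ ℓ → T a w ℓ R y ≡ R y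
T-offLevel a {w} {ℓ} R {y} offLevel with ⟨ y , w ⟩ ℤ.≟ ℓ
... | yes onLevel = contradiction onLevel offLevel
... | no _ = refl

Supported : ∀ {n} → (Fin n → ℕ) → Subset n → Set
Supported a S = ∀ x → S x ≡ true → InP a x

Supported⇒false : ∀ {n} {a : Fin n → ℕ} {S} → Supported a S → ∀ {x} → ¬ InP a x → S x ≡ false
Supported⇒false {S = S} S⊆P {x} x∉P with S x in Sx
... | true = contradiction (S⊆P x Sx) x∉P
... | false = refl

toggleValue-supported : ∀ {n} (a : Fin n → ℕ) {S} → Supported a S → ∀ x → toggleValue a S x ≡ true → InP a x
toggleValue-supported a {S} S⊆P x tx with S x in Sx
... | true = S⊆P x Sx
... | false = inPᵇ⇒InP a x (∧-conicalˡ _ _ tx)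

T-supported : ∀ {n} (a : Fin n → ℕ) w ℓ {S} → Supported a S → Supported a (T a w ℓ S)
T-supported a w ℓ {S} S⊆P y Ty with ⟨ y , w ⟩ ℤ.≟ ℓ
... | yes _ = toggleValue-supported a S⊆P y (trans (sym (toggle-diagonal a y S)) Ty)
... | no _ = S⊆P y Ty

foldl-T-supported : ∀ {n} (a : Fin n → ℕ) w ℓs {S} → Supported a S →
  Supported a (foldl (λ R ℓ → T a w ℓ R) S ℓs)
foldl-T-supported a w [] S⊆P = S⊆P
foldl-T-supported a w (ℓ ∷ ℓs) S⊆P = foldl-T-supported a w ℓs (T-supported a w ℓ S⊆P)

Pro-supported : ∀ {n} (a : Fin n → ℕ) w {S} → Supported a S → Supported a (Pro a w S)
Pro-supported a w = foldl-T-supported a w (levels a)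

iter-Pro-supported : ∀ {n} (a : Fin n → ℕ) w k {S} → Supported a S → Supported a (iter k (Pro a w) S)
iter-Pro-supported a w zero S⊆P = S⊆P
iter-Pro-supported a w (suc k) S⊆P = Pro-supported a w (iter-Pro-supported a w k S⊆P)

module _ {n} (a : Fin n → ℕ) (w : SignVec n) (S : Subset n) where

  stage : ℕ → Subset n
  stage k = foldl (λ R ℓ → T a w ℓ R) S (map (level a) (upTo k))

  stage-suc : ∀ k → stage (suc k) ≡ T a w (level a k) (stage k)
  stage-suc k = begin
    stage (suc k)                                       ≡⟨ cong (foldl step S ∘ map (level a)) (upTo-∷ʳ k) ⟨
    foldl step S (map (level a) (upTo k ++ [ k ]))      ≡⟨ cong (foldl step S) (map-++ (level a) (upTo k) [ k ]) ⟩
    foldl step S (map (level a) (upTo k) ∷ʳ level a k)  ≡⟨ foldl-∷ʳ step S (level a k) (map (level a) (upTo k)) ⟩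
    T a w (level a k) (stage k)                         ∎
    where
    open ≡-Reasoning
    step : Subset n → ℤ → Subset n
    step R ℓ = T a w ℓ R

  stage-stable : ∀ y {k m} → k ≤ m → (∀ j → k ≤ j → j < m → ¬ HasDepth a w y j) → stage m y ≡ stage k y
  stage-stable y {k} {m} k≤m untouched = begin
    stage m y              ≡⟨ cong (λ t → stage t y) (ℕP.m∸n+n≡m k≤m) ⟨
    stage (m ∸ k ℕ.+ k) y  ≡⟨ frozen (m ∸ k) (λ j k≤j → untouched j k≤j ∘ subst (j <_) (ℕP.m∸n+n≡m k≤m)) ⟩
    stage k y              ∎
    where
    open ≡-Reasoning
    frozen : ∀ r → (∀ j → k ≤ j → j < r ℕ.+ k → ¬ HasDepth a w y j) → stage (r ℕ.+ k) y ≡ stage k y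
    frozen zero _ = refl
    frozen (suc r) untouched′ =
      trans (cong (λ R → R y) (stage-suc (r ℕ.+ k)))
        (trans (T-offLevel a (stage (r ℕ.+ k)) (untouched-now ∘ level-depth {a = a} {w} {y}))
               (frozen r (λ j k≤j → untouched′ j k≤j ∘ ℕP.m<n⇒m<1+n)))
      where
      untouched-now : ¬ HasDepth a w y (r ℕ.+ k)
      untouched-now = untouched′ (r ℕ.+ k) (ℕP.m≤n+m k r) (ℕP.n<1+n _)

  -- state is the configuration of Pro_w S just before the level of x is toggled.
  record PreToggle (x : Point n) : Set where
    field
      state       : Subset n
      state-at    : state x ≡ S x
      state-above : ∀ z → ⟨ z , w ⟩ ≡ ⟨ x , w ⟩ ℤ.+ + 1 → state z ≡ Pro a w S z
      state-below : ∀ z → ⟨ x , w ⟩ ≡ ⟨ z , w ⟩ ℤ.+ + 1 → state z ≡ S z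
      Pro≡toggle  : Pro a w S x ≡ toggleValue a state x

  preToggle : ∀ {x} → InP a x → PreToggle x
  preToggle {x} x∈P with depth-exists a w x∈P
  ... | d , d≤2N , x-depth = record
    { state       = stage d
    ; state-at    = stage-stable x z≤n λ j _ j<d j-depth → ℕP.<⇒≢ j<d (depth-unique j-depth x-depth)
    ; state-above = λ z z-above → sym (stage-stable z (ℕP.m≤n⇒m≤1+n d≤2N) λ j d≤j _ j-depth →
        ℕP.n≮n j (subst (_≤ j) (sym (depth-unique (depth-below z-above j-depth) x-depth)) d≤j))
    ; state-below = λ z x-above → stage-stable z z≤n λ j _ j<d j-depth →
        ℕP.<-asym j<d (subst (d <_) (sym (depth-unique j-depth (depth-below x-above x-depth))) (ℕP.n<1+n d))
    ; Pro≡toggle  = begin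
        stage (suc (2 ℕ.* total a)) x  ≡⟨ stage-stable x (s≤s d≤2N) (λ j d<j _ j-depth →
                                            ℕP.<⇒≢ d<j (sym (depth-unique j-depth x-depth))) ⟩
        stage (suc d) x                ≡⟨ cong (λ R → R x) (stage-suc d) ⟩
        T a w (level a d) (stage d) x  ≡⟨ T-onLevel a (stage d) (depth-level x-depth) ⟩
        toggleValue a (stage d) x      ∎
    }
    where open ≡-Reasoning

iter-shift : ∀ {A : Set} k (f : A → A) x → iter k f (f x) ≡ iter (suc k) f x
iter-shift zero    f x = refl
iter-shift (suc k) f x = cong f (iter-shift k f x)

unionUpTo-witness : ∀ {n} m (F : ℕ → Subset n) {y} → unionUpTo m F y ≡ true → Σ[ j ∈ ℕ ] F j y ≡ true
unionUpTo-witness (suc m) F {y} ⋃F with unionUpTo m F y in ⋃ₘF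
... | true  = unionUpTo-witness m F ⋃ₘF
... | false = suc m , ⋃F

unionUpTo-layers-beyond : ∀ {n} (γ : Fin n) (H : ℕ → Subset n) m {y : Point n} → m < y γ →
  unionUpTo m (λ i → L i γ (H i)) y ≡ false
unionUpTo-layers-beyond γ H zero m<yγ = refl
unionUpTo-layers-beyond γ H (suc m) {y} m<yγ =
  cong₂ (λ p q → p ∨ q ∧ H (suc m) y)
    (unionUpTo-layers-beyond γ H m (ℕP.<-trans (ℕP.n<1+n m) m<yγ))
    (dec-false (y γ ℕ.≟ suc m) (ℕP.>⇒≢ m<yγ))

unionUpTo-layers : ∀ {n} (γ : Fin n) (H : ℕ → Subset n) m {y : Point n} {j} → y γ ≡ j → 1 ≤ j → j ≤ m →
  unionUpTo m (λ i → L i γ (H i)) y ≡ H j y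
unionUpTo-layers γ H zero yγ≡j 1≤j j≤0 = contradiction (ℕP.≤-trans 1≤j j≤0) λ ()
unionUpTo-layers γ H (suc m) {y} yγ≡j 1≤j j≤1+m with ℕP.m≤n⇒m<n∨m≡n j≤1+m
... | inj₁ j<1+m = trans
  (cong₂ (λ p q → p ∨ q ∧ H (suc m) y)
    (unionUpTo-layers γ H m yγ≡j 1≤j (ℕP.≤-pred j<1+m))
    (dec-false (y γ ℕ.≟ suc m) (ℕP.<⇒≢ (subst (_< suc m) (sym yγ≡j) j<1+m))))
  (∨-identityʳ _)
... | inj₂ refl =
  cong₂ (λ p q → p ∨ q ∧ H (suc m) y)
    (unionUpTo-layers-beyond γ H m (subst (m <_) (sym yγ≡j) (ℕP.n<1+n m)))
    (dec-true (y γ ℕ.≟ suc m) yγ≡j)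

Δ-supported : ∀ {n} (a : Fin n → ℕ) γ v {S : Subset n} → Supported a S → Supported a (Δ a γ v S)
Δ-supported a γ v {S} S⊆P y Δy with unionUpTo-witness (a γ) (λ j → L j γ (iter (j ∸ 1) (Pro a v) S)) Δy
... | j , Lⱼy = iter-Pro-supported a v (j ∸ 1) S⊆P y (∧-conicalʳ _ _ Lⱼy)

Δ-at : ∀ {n} (a : Fin n → ℕ) γ v {S : Subset n} → Supported a S →
  ∀ {y k} → y γ ≡ suc k → Δ a γ v S y ≡ iter k (Pro a v) S y
Δ-at a γ v S⊆P {y} {k} yγ with suc k ℕ.≤? a γ
... | yes 1+k≤aγ = unionUpTo-layers γ _ (a γ) yγ (s≤s z≤n) 1+k≤aγ
... | no 1+k≰aγ = trans (unionUpTo-layers-beyond γ _ (a γ) (subst (a γ <_) (sym yγ) (ℕP.≰⇒> 1+k≰aγ)))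
                        (sym (Supported⇒false (iter-Pro-supported a v k S⊆P) y∉P))
  where
  y∉P : ¬ InP a y
  y∉P y∈P = 1+k≰aγ (subst (_≤ a γ) yγ (proj₂ (y∈P γ)))

Δ-Pro-at : ∀ {n} (a : Fin n → ℕ) γ v {S : Subset n} → Supported a S →
  ∀ {y k} → y γ ≡ k → Δ a γ v (Pro a v S) y ≡ iter k (Pro a v) S y
Δ-Pro-at a γ v S⊆P {y} {zero} yγ =
  trans (Supported⇒false (Δ-supported a γ v (Pro-supported a v S⊆P)) y∉P) (sym (Supported⇒false S⊆P y∉P))
  where
  y∉P : ¬ InP a y
  y∉P y∈P = ℕP.n≮n 0 (subst (1 ≤_) yγ (proj₁ (y∈P γ)))
Δ-Pro-at a γ v {S} S⊆P {y} {suc k} yγ =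
  trans (Δ-at a γ v (Pro-supported a v S⊆P) yγ) (cong (λ R → R y) (iter-shift k (Pro a v) S))

module _ {n} (a : Fin n → ℕ) {I : Subset n} (I⊆P : Supported a I) {v u : SignVec n} {γ : Fin n}
         (vγ : v γ ≡ Sign.+) (uγ : u γ ≡ Sign.-) (v≡u : ∀ j → j ≢ γ → v j ≡ u j) where

  private
    orbit : ℕ → Subset n
    orbit k = iter k (Pro a v) I

    D : Subset n
    D = Δ a γ v I

    Agree : Point n → Set
    Agree y = Pro a u D y ≡ Δ a γ v (Pro a v I) y

  agree-outside : ∀ {y} → ¬ InP a y → Agree y
  agree-outside y∉P =
    trans (Supported⇒false (Pro-supported a u (Δ-supported a γ v I⊆P)) y∉P)
          (sym (Supported⇒false (Δ-supported a γ v (Pro-supported a v I⊆P)) y∉P))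

  agree-if-in-P : ∀ {y} → (InP a y → Agree y) → Agree y
  agree-if-in-P {y} agree-in with inPᵇ a y in y∈?
  ... | true  = agree-in (inPᵇ⇒InP a y y∈?)
  ... | false = agree-outside λ y∈P → contradiction (trans (sym (InP⇒inPᵇ a y y∈P)) y∈?) λ ()

  module Neighbours {y c} (y∈P : InP a y) (yγ : y γ ≡ suc c)
                    (agree-above : ∀ z → ⟨ z , u ⟩ ≡ ⟨ y , u ⟩ ℤ.+ + 1 → Agree z) where

    module U = PreToggle (preToggle a u D y∈P)
    module V = PreToggle (preToggle a v (orbit c) y∈P)

    u-above : ∀ z {k} → ⟨ z , u ⟩ ≡ ⟨ y , u ⟩ ℤ.+ + 1 → z γ ≡ k → U.state z ≡ orbit k z
    u-above z z-above zγ = trans (U.state-above z z-above) (trans (agree-above z z-above) (Δ-Pro-at a γ v I⊆P zγ))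

    u-below : ∀ z {k} → ⟨ y , u ⟩ ≡ ⟨ z , u ⟩ ℤ.+ + 1 → z γ ≡ suc k → U.state z ≡ orbit k z
    u-below z y-above zγ = trans (U.state-below z y-above) (Δ-at a γ v I⊆P zγ)

    layer-kept : ∀ {i f} → i ≢ γ → updateAt y i f γ ≡ suc c
    layer-kept i≢γ = trans (updateAt-minimal γ _ y (i≢γ ∘ sym)) yγ

    same-at : U.state y ≡ V.state y
    same-at = trans U.state-at (trans (Δ-at a γ v I⊆P yγ) (sym V.state-at))

    -- Moving along e_γ changes the u- and the v-level in opposite directions and shifts the
    -- γ-coordinate, i.e. the layer index; along e_i, i ≢ γ, both levels move alike and the layer stays.
    same-up : ∀ i → U.state (up y i) ≡ V.state (up y i)
    same-up i with i Fin.≟ γ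
    ... | yes refl =
      trans (u-below (up y γ) (up-lowers-level y uγ) (trans (updateAt-updates γ y) (cong suc yγ)))
            (sym (V.state-above (up y γ) (up-raises-level y vγ)))
    ... | no i≢γ with u i in uᵢ
    ...   | Sign.+ =
      trans (u-above (up y i) (up-raises-level y uᵢ) (layer-kept i≢γ))
            (sym (V.state-above (up y i) (up-raises-level y (trans (v≡u i i≢γ) uᵢ))))
    ...   | Sign.- =
      trans (u-below (up y i) (up-lowers-level y uᵢ) (layer-kept i≢γ))
            (sym (V.state-below (up y i) (up-lowers-level y (trans (v≡u i i≢γ) uᵢ))))

    same-down : ∀ i → U.state (down y i) ≡ V.state (down y i)
    same-down i with proj₁ (y∈P i) | i Fin.≟ γ
    ... | 1≤yᵢ | yes refl =
      trans (u-above (down y γ) (down-raises-level y 1≤yᵢ uγ) (trans (updateAt-updates γ y) (cong (_∸ 1) yγ)))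
            (sym (V.state-below (down y γ) (down-lowers-level y 1≤yᵢ vγ)))
    ... | 1≤yᵢ | no i≢γ with u i in uᵢ
    ...   | Sign.+ =
      trans (u-below (down y i) (down-lowers-level y 1≤yᵢ uᵢ) (layer-kept i≢γ))
            (sym (V.state-below (down y i) (down-lowers-level y 1≤yᵢ (trans (v≡u i i≢γ) uᵢ))))
    ...   | Sign.- =
      trans (u-above (down y i) (down-raises-level y 1≤yᵢ uᵢ) (layer-kept i≢γ))
            (sym (V.state-above (down y i) (down-raises-level y 1≤yᵢ (trans (v≡u i i≢γ) uᵢ))))

  agree-from-above : ∀ {y c} → InP a y → y γ ≡ suc c →
    (∀ z → ⟨ z , u ⟩ ≡ ⟨ y , u ⟩ ℤ.+ + 1 → Agree z) → Agree y
  agree-from-above {y} {c} y∈P yγ agree-above = begin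
    Pro a u D y              ≡⟨ U.Pro≡toggle ⟩
    toggleValue a U.state y  ≡⟨ toggleValue-local a {U.state} {V.state} y same-at same-up same-down ⟩
    toggleValue a V.state y  ≡⟨ V.Pro≡toggle ⟨
    orbit (suc c) y          ≡⟨ Δ-Pro-at a γ v I⊆P yγ ⟨
    Δ a γ v (Pro a v I) y    ∎
    where
    open ≡-Reasoning
    open Neighbours y∈P yγ agree-above

  agree-at-depth : ∀ d {y} → InP a y → HasDepth a u y d → Agree y
  agree-above-depth : ∀ d {y} → HasDepth a u y d → ∀ z → ⟨ z , u ⟩ ≡ ⟨ y , u ⟩ ℤ.+ + 1 → InP a z → Agree z

  agree-at-depth d y∈P y-depth =
    agree-from-above y∈P (sym (suc[m∸1]≡m (proj₁ (y∈P γ))))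
      λ z z-above → agree-if-in-P (agree-above-depth d y-depth z z-above)

  agree-above-depth d y-depth z z-above z∈P with depth-exists a u z∈P
  ... | d′ , _ , z-depth with refl ← depth-unique (depth-below z-above z-depth) y-depth =
    agree-at-depth d′ z∈P z-depth

  Pro∘Δ≗Δ∘Pro : ∀ x → Pro a u (Δ a γ v I) x ≡ Δ a γ v (Pro a v I) x
  Pro∘Δ≗Δ∘Pro x = agree-if-in-P λ x∈P →
    let d , _ , x-depth = depth-exists a u x∈P in agree-at-depth d x∈P x-depth

theorem4p5 : (n : ℕ) (a : Fin n → ℕ) (I : Subset n) → IsOrderIdeal a I →
    (v u : SignVec n) (γ : Fin n) →
    v γ ≡ Sign.+ → u γ ≡ Sign.- → (∀ j → j ≢ γ → v j ≡ u j) →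
    ∀ x → Pro a u (Δ a γ v I) x ≡ Δ a γ v (Pro a v I) x
theorem4p5 n a I (I⊆P , _) v u γ vγ uγ v≡u = Pro∘Δ≗Δ∘Pro a I⊆P vγ uγ v≡u
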